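{- Let $T$ be a tree on $n$ vertices that has a perfect matching $M$ and is strongly graceful. Define the permutation $g_2$ of $\{0,1,\dots,n-1\}$ by $g_2(a)=n-2-a$ if $a$ is even and $g_2(a)=n-a$ if $a$ is odd; thus (i) if $n/2$ is even, $g_2=(0\ n-2)(1\ n-1)(2\ n-4)(3\ n-3)\cdots(\tfrac n2-2\ \tfrac n2)(\tfrac n2-1\ \tfrac n2+1)$, and (ii) if $n/2$ is odd, $g_2=(0\ n-2)(1\ n-1)\cdots(\tfrac n2-3\ \tfrac n2+1)(\tfrac n2-2\ \tfrac n2+2)(\tfrac n2-1)(\tfrac n2)$. Then $g_2$ is a generalised strongly graceful permutation of $T$: for every strongly graceful labelling $f$ of $T$, the labelling $g_2\circ f$ is again a strongly graceful labelling of $T$.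
   Context: A graceful labelling of a tree $T$ is a bijection $f:V(T)\to\{0,1,\dots,|E(T)|\}$ such that the induced edge labels $|f(u)-f(v)|$ ($uv\in E(T)$) are pairwise distinct. If $T$ has a perfect matching $M$, a strongly graceful labelling of $T$ is a graceful labelling $f$ with $f(x)+f(y)=|V(T)|-1$ for every $xy\in M$; $T$ is strongly graceful if it admits one. A permutation $g$ of $\{0,\dots,|V(T)|-1\}$ is a generalised strongly graceful permutation of $T$ if for every strongly graceful labelling $f$ of $T$, the labelling $g\circ f$ is strongly graceful. -}

module Defs where

open import Data.Nat using (ℕ; zero; suc; _+_; _∸_; _≤_; _<_; _%_; _≡ᵇ_; _<ᵇ_; ∣_-_∣)
open import Data.Fin using (Fin; toℕ)
open import Data.Bool using (Bool; true; false; _∧_; if_then_else_)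
open import Data.List using (List; []; _∷_; _++_; [_]; length; filterᵇ; cartesianProduct)
open import Data.List.Relation.Unary.Unique.Propositional using (Unique)
open import Data.List.Relation.Unary.Linked using (Linked)
open import Data.Fin.Base using () renaming (_<_ to _<ᶠ_)
open import Data.Vec.Functional using () 
open import Data.List using (allFin) 
open import Data.Product using (Σ; _×_; _,_; ∃)
open import Relation.Nullary using (¬_)
open import Relation.Binary.PropositionalEquality using (_≡_)

record SimpleGraph (n : ℕ) : Set where
  field
    adj    : Fin n → Fin n → Bool
    sym    : ∀ i j → adj i j ≡ adj j i
    irrefl : ∀ i → adj i i ≡ false
open SimpleGraph public

Adj : ∀ {n} → SimpleGraph n → Fin n → Fin n → Set
Adj G i j = adj G i j ≡ true

data Walk {n : ℕ} (G : SimpleGraph n) : Fin n → Fin n → Set where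
  nil  : ∀ {i} → Walk G i i
  cons : ∀ {i j k} → Adj G i j → Walk G j k → Walk G i k

Connected : ∀ {n} → SimpleGraph n → Set
Connected G = ∀ i j → Walk G i j

HasCycle : ∀ {n} → SimpleGraph n → Set
HasCycle {n} G = Σ (Fin n) λ v → Σ (List (Fin n)) λ ws →
  (2 ≤ length ws) × Unique (v ∷ ws) × Linked (Adj G) (v ∷ ws ++ [ v ])

Acyclic : ∀ {n} → SimpleGraph n → Set
Acyclic G = ¬ HasCycle G

IsTree : ∀ {n} → SimpleGraph n → Set
IsTree G = Connected G × Acyclic G

IsEdge : ∀ {n} → SimpleGraph n → Fin n → Fin n → Set
IsEdge G i j = (i <ᶠ j) × Adj G i j

edgeList : ∀ {n} → SimpleGraph n → List (Fin n × Fin n)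
edgeList {n} G = filterᵇ (λ { (i , j) → (toℕ i <ᵇ toℕ j) ∧ adj G i j })
                         (cartesianProduct (allFin n) (allFin n))

numEdges : ∀ {n} → SimpleGraph n → ℕ
numEdges G = length (edgeList G)

IsGraceful : ∀ {n} → SimpleGraph n → (Fin n → ℕ) → Set
IsGraceful {n} G f =
  (∀ v → f v ≤ numEdges G) ×
  (∀ u v → f u ≡ f v → u ≡ v) ×
  (∀ a → a ≤ numEdges G → ∃ λ v → f v ≡ a) ×
  (∀ i j k l → IsEdge G i j → IsEdge G k l →
     ∣ f i - f j ∣ ≡ ∣ f k - f l ∣ → (i ≡ k × j ≡ l))

-- A perfect matching M of G, encoded by the partner map: the edges of M
-- are exactly the pairs {v, mate v}; each vertex lies in exactly one.
record PerfectMatching {n : ℕ} (G : SimpleGraph n) : Set where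
  field
    mate     : Fin n → Fin n
    mate-adj : ∀ v → Adj G v (mate v)
    mate-inv : ∀ v → mate (mate v) ≡ v
open PerfectMatching public

InMatching : ∀ {n} {G : SimpleGraph n} → PerfectMatching G → Fin n → Fin n → Set
InMatching M x y = mate M x ≡ y

IsStronglyGraceful : ∀ {n} (G : SimpleGraph n) → PerfectMatching G → (Fin n → ℕ) → Set
IsStronglyGraceful {n} G M f =
  IsGraceful G f × (∀ x y → InMatching M x y → f x + f y ≡ n ∸ 1)

StronglyGraceful : ∀ {n} (G : SimpleGraph n) → PerfectMatching G → Set
StronglyGraceful {n} G M = ∃ λ (f : Fin n → ℕ) → IsStronglyGraceful G M f

IsPermutationOn : ℕ → (ℕ → ℕ) → Set
IsPermutationOn n g =
  (∀ a → a < n → g a < n) ×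
  (∀ a b → a < n → b < n → g a ≡ g b → a ≡ b) ×
  (∀ b → b < n → ∃ λ a → a < n × g a ≡ b)

IsGenStronglyGracefulPerm : ∀ {n} (G : SimpleGraph n) → PerfectMatching G → (ℕ → ℕ) → Set
IsGenStronglyGracefulPerm {n} G M g =
  IsPermutationOn n g ×
  (∀ (f : Fin n → ℕ) → IsStronglyGraceful G M f →
     IsStronglyGraceful G M (λ v → g (f v)))

g₂ : ℕ → ℕ → ℕ
g₂ n a = if a % 2 ≡ᵇ 0 then n ∸ 2 ∸ a else n ∸ a

-- Write labels as 2q + r with r ∈ {0,1}. A strongly graceful tree has n = 2k + 2 vertices, and
-- g₂ sends 2q + r to 2(k − q) + r: it reflects each parity class of {0, …, n − 1}, is an
-- involution, and maps complementary pairs a + b = n − 1 to complementary pairs.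
-- In a strongly graceful labelling every edge either joins a complementary pair or joins two
-- labels of equal parity, since an edge with odd label 2w + 1 shares that label with the matching
-- edge between the vertices labelled k − w and k + w + 1. Edges of the second kind keep their
-- (even) label under g₂; matched edges keep odd labels, and these stay distinct because a pair
-- of numbers is determined by its sum and its difference.
module Submission where

open import Defs hiding (sym)
open import Data.Bool using (Bool; true; false; not)
open import Data.Bool.Properties using (¬-not) renaming (_≟_ to _≟ᵇ_)
open import Data.Empty using (⊥-elim)
open import Data.Fin using (Fin)
open import Data.Fin.Properties using () renaming (<-cmp to <-cmpᶠ)
open import Data.Nat using (ℕ; zero; suc; _+_; _*_; _∸_; _≤_; _<_; z≤n; s≤s; _%_; ∣_-_∣)
open import Data.Nat.DivMod using (m*n%n≡0; [m+kn]%n≡m%n)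
open import Data.Nat.Properties
open import Data.Nat.Tactic.RingSolver using (solve-∀)
open import Data.Product using (∃; ∃₂; _×_; _,_; proj₁; proj₂)
open import Data.Sum using (_⊎_; inj₁; inj₂)
open import Function using (_∘_)
open import Relation.Binary using (tri<; tri≈; tri>)
open import Relation.Binary.PropositionalEquality
open import Relation.Nullary using (yes; no)

⟦_,_⟧ : ℕ → Bool → ℕ
⟦ q , false ⟧ = 2 * q
⟦ q , true ⟧ = suc (2 * q)

Parity : Bool → ℕ → Set
Parity r a = ∃ λ q → a ≡ ⟦ q , r ⟧

halve : ∀ a → ∃₂ λ q r → a ≡ ⟦ q , r ⟧
halve zero = 0 , false , refl
halve (suc a) with halve a
... | q , false , refl = q , true , refl
... | q , true , refl = suc q , false , sym (*-suc 2 q)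

⟦⟧-injective : ∀ {q p r s} → ⟦ q , r ⟧ ≡ ⟦ p , s ⟧ → q ≡ p × r ≡ s
⟦⟧-injective {q} {p} {false} {false} e = *-cancelˡ-≡ q p 2 e , refl
⟦⟧-injective {q} {p} {true}  {true}  e = *-cancelˡ-≡ q p 2 (suc-injective e) , refl
⟦⟧-injective {q} {p} {false} {true}  e = ⊥-elim (even≢odd q p e)
⟦⟧-injective {q} {p} {true}  {false} e = ⊥-elim (even≢odd p q (sym e))

Parity-unique : ∀ {r s a} → Parity r a → Parity s a → r ≡ s
Parity-unique (q , refl) (p , e) = proj₂ (⟦⟧-injective e)

⟦⟧≤⟦⟧⇒≤ : ∀ {q r k} → ⟦ q , r ⟧ ≤ ⟦ k , true ⟧ → q ≤ k
⟦⟧≤⟦⟧⇒≤ {q} {true}      (s≤s h) = *-cancelˡ-≤ 2 h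
⟦⟧≤⟦⟧⇒≤ {q} {false} {k} h       =
  ≤-pred (*-cancelˡ-< 2 q (suc k) (subst (2 * q <_) (sym (*-suc 2 k)) (s≤s h)))

≤⇒⟦⟧≤⟦⟧ : ∀ {q k} r → q ≤ k → ⟦ q , r ⟧ ≤ ⟦ k , true ⟧
≤⇒⟦⟧≤⟦⟧ false q≤k = m≤n⇒m≤1+n (*-monoʳ-≤ 2 q≤k)
≤⇒⟦⟧≤⟦⟧ true  q≤k = s≤s (*-monoʳ-≤ 2 q≤k)

⟦⟧+⟦⟧-opposite : ∀ q p r → ⟦ q , r ⟧ + ⟦ p , not r ⟧ ≡ ⟦ q + p , true ⟧
⟦⟧+⟦⟧-opposite q p false = trans (+-suc (2 * q) (2 * p)) (cong suc (sym (*-distribˡ-+ 2 q p)))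
⟦⟧+⟦⟧-opposite q p true  = cong suc (sym (*-distribˡ-+ 2 q p))

⟦⟧+⟦⟧-equal : ∀ q p r → Parity false (⟦ q , r ⟧ + ⟦ p , r ⟧)
⟦⟧+⟦⟧-equal q p false = q + p , sym (*-distribˡ-+ 2 q p)
⟦⟧+⟦⟧-equal q p true  = suc (q + p) , odd+odd q p
  where
  odd+odd : ∀ q p → suc (2 * q) + suc (2 * p) ≡ 2 * suc (q + p)
  odd+odd = solve-∀

2*m+⟦⟧ : ∀ m q r → 2 * m + ⟦ q , r ⟧ ≡ ⟦ m + q , r ⟧
2*m+⟦⟧ m q false = sym (*-distribˡ-+ 2 m q)
2*m+⟦⟧ m q true  = trans (+-suc (2 * m) (2 * q)) (cong suc (sym (*-distribˡ-+ 2 m q)))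

Parity-cancel-2* : ∀ {r} m t → Parity r (2 * m + t) → Parity r t
Parity-cancel-2* {r} m t (z , e) with halve t
... | q , s , refl with ⟦⟧-injective {m + q} {z} {s} {r} (trans (sym (2*m+⟦⟧ m q s)) e)
... | _ , refl = q , refl

data Gap : ℕ → ℕ → Set where
  below : ∀ x t → Gap x (x + t)
  above : ∀ x t → Gap (x + t) x

gap : ∀ m n → Gap m n
gap zero    n       = below 0 n
gap (suc m) zero    = above 0 (suc m)
gap (suc m) (suc n) with gap m n
... | below x t = below (suc x) t
... | above x t = above (suc x) t

gap-base : ∀ {m n} → Gap m n → ℕ
gap-base (below x _) = x
gap-base (above x _) = x

gap-length : ∀ {m n} → Gap m n → ℕ
gap-length (below _ t) = t
gap-length (above _ t) = t

gap-distance : ∀ {m n} (γ : Gap m n) → ∣ m - n ∣ ≡ gap-length γ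
gap-distance (below x t) = ∣m-m+n∣≡n x t
gap-distance (above x t) = trans (∣-∣-comm (x + t) x) (∣m-m+n∣≡n x t)

gap-sum : ∀ {m n} (γ : Gap m n) → m + n ≡ 2 * gap-base γ + gap-length γ
gap-sum (below x t) = below-sum x t
  where
  below-sum : ∀ x t → x + (x + t) ≡ 2 * x + t
  below-sum = solve-∀
gap-sum (above x t) = above-sum x t
  where
  above-sum : ∀ x t → (x + t) + x ≡ 2 * x + t
  above-sum = solve-∀

m+n≡2x+∣m-n∣ : ∀ m n → ∃ λ x → m + n ≡ 2 * x + ∣ m - n ∣
m+n≡2x+∣m-n∣ m n = gap-base γ , trans (gap-sum γ) (cong (2 * gap-base γ +_) (sym (gap-distance γ)))
  where
  γ : Gap m n
  γ = gap m n

∣-∣-Parity : ∀ {r} m n → Parity r (m + n) → Parity r ∣ m - n ∣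
∣-∣-Parity {r} m n p with m+n≡2x+∣m-n∣ m n
... | x , e = Parity-cancel-2* {r} x ∣ m - n ∣ (subst (Parity r) e p)

gaps-determine : ∀ {m n o p} (γ : Gap m n) (δ : Gap o p) →
                 gap-base γ ≡ gap-base δ → gap-length γ ≡ gap-length δ → m ≡ o ⊎ m ≡ p
gaps-determine (below x t) (below y u) b l = inj₁ b
gaps-determine (below x t) (above y u) b l = inj₂ b
gaps-determine (above x t) (below y u) b l = inj₂ (cong₂ _+_ b l)
gaps-determine (above x t) (above y u) b l = inj₁ (cong₂ _+_ b l)

m+n≡o+p∧∣m-n∣≡∣o-p∣⇒m≡o⊎m≡p : ∀ {m n o p} → m + n ≡ o + p → ∣ m - n ∣ ≡ ∣ o - p ∣ → m ≡ o ⊎ m ≡ p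
m+n≡o+p∧∣m-n∣≡∣o-p∣⇒m≡o⊎m≡p {m} {n} {o} {p} s d = gaps-determine γ δ base≡ length≡
  where
  γ : Gap m n
  γ = gap m n
  δ : Gap o p
  δ = gap o p
  length≡ : gap-length γ ≡ gap-length δ
  length≡ = trans (sym (gap-distance γ)) (trans d (gap-distance δ))
  base≡ : gap-base γ ≡ gap-base δ
  base≡ = *-cancelˡ-≡ _ _ 2 (+-cancelʳ-≡ (gap-length δ) _ _ (begin
    2 * gap-base γ + gap-length δ ≡⟨ cong (2 * gap-base γ +_) length≡ ⟨
    2 * gap-base γ + gap-length γ ≡⟨ gap-sum γ ⟨
    m + n                         ≡⟨ s ⟩
    o + p                         ≡⟨ gap-sum δ ⟩
    2 * gap-base δ + gap-length δ ∎))
    where open ≡-Reasoning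

m+n≡o+p⇒∣m-o∣≡∣p-n∣ : ∀ {m n o p} → m + n ≡ o + p → ∣ m - o ∣ ≡ ∣ p - n ∣
m+n≡o+p⇒∣m-o∣≡∣p-n∣ {m} {n} {o} {p} e = begin
  ∣ m - o ∣         ≡⟨ ∣m+n-m+o∣≡∣n-o∣ n m o ⟨
  ∣ n + m - n + o ∣ ≡⟨ cong₂ ∣_-_∣ (trans (+-comm n m) e) (+-comm n o) ⟩
  ∣ o + p - o + n ∣ ≡⟨ ∣m+n-m+o∣≡∣n-o∣ o p n ⟩
  ∣ p - n ∣         ∎
  where open ≡-Reasoning

g₂-even : ∀ n {a} → a % 2 ≡ 0 → g₂ n a ≡ n ∸ 2 ∸ a
g₂-even n e rewrite e = refl

g₂-odd : ∀ n {a} → a % 2 ≡ 1 → g₂ n a ≡ n ∸ a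
g₂-odd n e rewrite e = refl

module Reflection (k : ℕ) where

  S : ℕ
  S = ⟦ k , true ⟧

  g : ℕ → ℕ
  g = g₂ (suc S)

  digits : ∀ {a} → a ≤ S → ∃₂ λ q r → q ≤ k × a ≡ ⟦ q , r ⟧
  digits {a} a≤S with halve a
  ... | q , r , refl = q , r , ⟦⟧≤⟦⟧⇒≤ {q} {r} a≤S , refl

  g-⟦⟧ : ∀ {q} r → q ≤ k → g ⟦ q , r ⟧ ≡ ⟦ k ∸ q , r ⟧
  g-⟦⟧ {q} false q≤k = begin
    g (2 * q)     ≡⟨ g₂-even (suc S) {2 * q} (trans (cong (_% 2) (*-comm 2 q)) (m*n%n≡0 q 2)) ⟩
    2 * k ∸ 2 * q ≡⟨ *-distribˡ-∸ 2 k q ⟨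
    2 * (k ∸ q)   ∎
    where open ≡-Reasoning
  g-⟦⟧ {q} true  q≤k = begin
    g (suc (2 * q))      ≡⟨ g₂-odd (suc S) {suc (2 * q)}
                              (trans (cong (λ x → suc x % 2) (*-comm 2 q)) ([m+kn]%n≡m%n 1 q 2)) ⟩
    suc (2 * k) ∸ 2 * q  ≡⟨ +-∸-assoc 1 (*-monoʳ-≤ 2 q≤k) ⟩
    suc (2 * k ∸ 2 * q)  ≡⟨ cong suc (*-distribˡ-∸ 2 k q) ⟨
    suc (2 * (k ∸ q))    ∎
    where open ≡-Reasoning

  ⟦⟧-complement : ∀ {q} r → q ≤ k → ⟦ q , r ⟧ + ⟦ k ∸ q , not r ⟧ ≡ S
  ⟦⟧-complement {q} r q≤k =
    trans (⟦⟧+⟦⟧-opposite q (k ∸ q) r) (cong (λ z → ⟦ z , true ⟧) (m+[n∸m]≡n q≤k))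

  k≤S : k ≤ S
  k≤S = m≤n⇒m≤1+n (m≤m+n k _)

  summandˡ≤S : ∀ {a b} → a + b ≡ S → a ≤ S
  summandˡ≤S {a} a+b≡S = m+n≤o⇒m≤o a (≤-reflexive a+b≡S)

  summandʳ≤S : ∀ {a b} → a + b ≡ S → b ≤ S
  summandʳ≤S {a} a+b≡S = m+n≤o⇒n≤o a (≤-reflexive a+b≡S)

  centred-pair : ∀ {w} → w ≤ k → (k ∸ w) + ((k ∸ w) + ⟦ w , true ⟧) ≡ S
  centred-pair {w} w≤k =
    trans (spread (k ∸ w) w) (cong (λ z → ⟦ z , true ⟧) (m∸n+n≡m w≤k))
    where
    spread : ∀ x w → x + (x + suc (2 * w)) ≡ suc (2 * (x + w))
    spread = solve-∀

  g-≤ : ∀ {a} → a ≤ S → g a ≤ S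
  g-≤ a≤S with digits a≤S
  ... | q , r , q≤k , refl rewrite g-⟦⟧ r q≤k = ≤⇒⟦⟧≤⟦⟧ r (m∸n≤m k q)

  g-involutive : ∀ {a} → a ≤ S → g (g a) ≡ a
  g-involutive a≤S with digits a≤S
  ... | q , r , q≤k , refl rewrite g-⟦⟧ r q≤k | g-⟦⟧ r (m∸n≤m k q) =
    cong (λ z → ⟦ z , r ⟧) (m∸[m∸n]≡n q≤k)

  g-injective : ∀ {a b} → a ≤ S → b ≤ S → g a ≡ g b → a ≡ b
  g-injective a≤S b≤S e = trans (sym (g-involutive a≤S)) (trans (cong g e) (g-involutive b≤S))

  g-isPermutation : IsPermutationOn (suc S) g
  g-isPermutation =
    (λ a a<N → s≤s (g-≤ (≤-pred a<N))) ,
    (λ a b a<N b<N → g-injective (≤-pred a<N) (≤-pred b<N)) ,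
    (λ b b<N → g b , s≤s (g-≤ (≤-pred b<N)) , g-involutive (≤-pred b<N))

  g-complement : ∀ a b → a + b ≡ S → g a + g b ≡ S
  g-complement a b a+b≡S with digits (summandˡ≤S {a} a+b≡S)
  ... | q , r , q≤k , refl
    with +-cancelˡ-≡ ⟦ q , r ⟧ b _ (trans a+b≡S (sym (⟦⟧-complement r q≤k)))
  ... | refl rewrite g-⟦⟧ r q≤k | g-⟦⟧ (not r) (m∸n≤m k q) = ⟦⟧-complement r (m∸n≤m k q)

  g-∣-∣-same-parity : ∀ {q p} r → q ≤ k → p ≤ k →
                      ∣ g ⟦ q , r ⟧ - g ⟦ p , r ⟧ ∣ ≡ ∣ ⟦ q , r ⟧ - ⟦ p , r ⟧ ∣
  g-∣-∣-same-parity {q} {p} r q≤k p≤k rewrite g-⟦⟧ r q≤k | g-⟦⟧ r p≤k = reflected r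
    where
    reflection-sum : ∀ {x} → x ≤ k → 2 * (k ∸ x) + 2 * x ≡ 2 * k
    reflection-sum {x} x≤k = trans (sym (*-distribˡ-+ 2 (k ∸ x) x)) (cong (2 *_) (m∸n+n≡m x≤k))
    reflected : ∀ r → ∣ ⟦ k ∸ q , r ⟧ - ⟦ k ∸ p , r ⟧ ∣ ≡ ∣ ⟦ q , r ⟧ - ⟦ p , r ⟧ ∣
    reflected false = trans (m+n≡o+p⇒∣m-o∣≡∣p-n∣ {2 * (k ∸ q)} {2 * q} {2 * (k ∸ p)} {2 * p}
                              (trans (reflection-sum q≤k) (sym (reflection-sum p≤k))))
                            (∣-∣-comm (2 * p) (2 * q))
    reflected true = reflected false

  data EdgeKind (a b : ℕ) : Set where
    complementary : a + b ≡ S → EdgeKind a b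
    same-parity   : ∀ {q p} r → q ≤ k → p ≤ k → a ≡ ⟦ q , r ⟧ → b ≡ ⟦ p , r ⟧ → EdgeKind a b

  complementary≢same-parity : ∀ a b q p r → a + b ≡ S → ∣ a - b ∣ ≢ ∣ ⟦ q , r ⟧ - ⟦ p , r ⟧ ∣
  complementary≢same-parity a b q p r a+b≡S d with
    Parity-unique {true} {false} (∣-∣-Parity {true} a b (k , a+b≡S))
                  (subst (Parity false) (sym d) (∣-∣-Parity {false} ⟦ q , r ⟧ ⟦ p , r ⟧ (⟦⟧+⟦⟧-equal q p r)))
  ... | ()

  complementary-∣-∣-reflected : ∀ a b c d → a + b ≡ S → c + d ≡ S →
                                ∣ g a - g b ∣ ≡ ∣ g c - g d ∣ → ∣ a - b ∣ ≡ ∣ c - d ∣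
  complementary-∣-∣-reflected a b c d a+b≡S c+d≡S e
    with m+n≡o+p∧∣m-n∣≡∣o-p∣⇒m≡o⊎m≡p {g a} {g b} {g c} {g d}
           (trans (g-complement a b a+b≡S) (sym (g-complement c d c+d≡S))) e
  ... | inj₁ ga≡gc with g-injective (summandˡ≤S {a} a+b≡S) (summandˡ≤S {c} c+d≡S) ga≡gc
  ...   | refl = cong (∣ a -_∣) (+-cancelˡ-≡ a b d (trans a+b≡S (sym c+d≡S)))
  complementary-∣-∣-reflected a b c d a+b≡S c+d≡S e
      | inj₂ ga≡gd with g-injective (summandˡ≤S {a} a+b≡S) (summandʳ≤S {c} c+d≡S) ga≡gd
  ...   | refl = begin
    ∣ a - b ∣ ≡⟨ cong (∣ a -_∣) (+-cancelˡ-≡ a b c (trans a+b≡S (trans (sym c+d≡S) (+-comm c a)))) ⟩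
    ∣ a - c ∣ ≡⟨ ∣-∣-comm a c ⟩
    ∣ c - a ∣ ∎
    where open ≡-Reasoning

  g-∣-∣-injective : ∀ {a b c d} → EdgeKind a b → EdgeKind c d →
                    ∣ g a - g b ∣ ≡ ∣ g c - g d ∣ → ∣ a - b ∣ ≡ ∣ c - d ∣
  g-∣-∣-injective {a} {b} {c} {d} (complementary a+b≡S) (complementary c+d≡S) e =
    complementary-∣-∣-reflected a b c d a+b≡S c+d≡S e
  g-∣-∣-injective (same-parity r q≤k p≤k refl refl) (same-parity s q′≤k p′≤k refl refl) e =
    trans (sym (g-∣-∣-same-parity r q≤k p≤k)) (trans e (g-∣-∣-same-parity s q′≤k p′≤k))
  g-∣-∣-injective {a} {b} (complementary a+b≡S) (same-parity {q} {p} r q≤k p≤k refl refl) e =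
    ⊥-elim (complementary≢same-parity (g a) (g b) q p r (g-complement a b a+b≡S)
             (trans e (g-∣-∣-same-parity r q≤k p≤k)))
  g-∣-∣-injective {c = c} {d} (same-parity {q} {p} r q≤k p≤k refl refl) (complementary c+d≡S) e =
    ⊥-elim (complementary≢same-parity (g c) (g d) q p r (g-complement c d c+d≡S)
             (trans (sym e) (g-∣-∣-same-parity r q≤k p≤k)))

Adj⇒≢ : ∀ {n} (G : SimpleGraph n) {u v} → Adj G u v → u ≢ v
Adj⇒≢ G {u} a refl with trans (sym a) (irrefl G u)
... | ()

Adj⇒IsEdge : ∀ {n} (G : SimpleGraph n) {u v} → Adj G u v → IsEdge G u v ⊎ IsEdge G v u
Adj⇒IsEdge G {u} {v} a with <-cmpᶠ u v
... | tri< u<v _ _ = inj₁ (u<v , a)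
... | tri≈ _ u≡v _ = ⊥-elim (Adj⇒≢ G a u≡v)
... | tri> _ _ v<u = inj₂ (v<u , trans (SimpleGraph.sym G v u) a)

module Labelling {n} (T : SimpleGraph n) (M : PerfectMatching T) (f : Fin n → ℕ)
                 (sg : IsStronglyGraceful T M f) where

  labels-bounded : ∀ v → f v ≤ numEdges T
  labels-bounded = proj₁ (proj₁ sg)

  labels-injective : ∀ u v → f u ≡ f v → u ≡ v
  labels-injective = proj₁ (proj₂ (proj₁ sg))

  labels-onto : ∀ a → a ≤ numEdges T → ∃ λ v → f v ≡ a
  labels-onto = proj₁ (proj₂ (proj₂ (proj₁ sg)))

  edge-labels-distinct : ∀ i j i′ j′ → IsEdge T i j → IsEdge T i′ j′ →
                         ∣ f i - f j ∣ ≡ ∣ f i′ - f j′ ∣ → i ≡ i′ × j ≡ j′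
  edge-labels-distinct = proj₂ (proj₂ (proj₂ (proj₁ sg)))

  matched-sum : ∀ v → f v + f (mate M v) ≡ n ∸ 1
  matched-sum v = proj₂ sg v (mate M v) refl

  numEdges≡n∸1 : numEdges T ≡ n ∸ 1
  numEdges≡n∸1 with labels-onto 0 z≤n | labels-onto (numEdges T) ≤-refl
  ... | v₀ , fv₀≡0 | v₁ , fv₁≡E = ≤-antisym E≤n∸1 n∸1≤E
    where
    E≤n∸1 : numEdges T ≤ n ∸ 1
    E≤n∸1 = subst (_≤ n ∸ 1) fv₁≡E (m+n≤o⇒m≤o (f v₁) (≤-reflexive (matched-sum v₁)))
    n∸1≤E : n ∸ 1 ≤ numEdges T
    n∸1≤E = subst (_≤ numEdges T) (trans (cong (_+ f (mate M v₀)) (sym fv₀≡0)) (matched-sum v₀))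
                  (labels-bounded (mate M v₀))

  -- If n − 1 = 2q, the vertex labelled q would be matched to the vertex labelled n − 1 − q = q.
  n∸1-odd : Parity true (n ∸ 1)
  n∸1-odd with halve (n ∸ 1)
  ... | q , true  , e = q , e
  ... | q , false , e with labels-onto q (subst (q ≤_) (sym (trans numEdges≡n∸1 e)) (m≤m+n q (1 * q)))
  ...   | v , fv≡q =
    ⊥-elim (Adj⇒≢ T (mate-adj M v) (labels-injective v (mate M v) (trans fv≡q (sym fmv≡q))))
    where
    n∸1≡q+q : n ∸ 1 ≡ q + q
    n∸1≡q+q = trans e (cong (q +_) (+-identityʳ q))
    fmv≡q : f (mate M v) ≡ q
    fmv≡q = +-cancelˡ-≡ q _ _ (trans (cong (_+ f (mate M v)) (sym fv≡q)) (trans (matched-sum v) n∸1≡q+q))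

  order≡2+2k : ∃ λ k → n ≡ suc ⟦ k , true ⟧
  order≡2+2k with n∸1-odd
  ... | k , e = k , pred-suc e
    where
    pred-suc : ∀ {m x} → m ∸ 1 ≡ suc x → m ≡ suc (suc x)
    pred-suc {suc m} e = cong suc e

  matching-edge-label-unique : ∀ {i j} v → IsEdge T i j →
                               ∣ f i - f j ∣ ≡ ∣ f v - f (mate M v) ∣ → f i + f j ≡ n ∸ 1
  matching-edge-label-unique v e d with Adj⇒IsEdge T (mate-adj M v)
  ... | inj₁ e′ with edge-labels-distinct _ _ v (mate M v) e e′ d
  ...   | refl , refl = matched-sum v
  matching-edge-label-unique v e d | inj₂ e′
    with edge-labels-distinct _ _ (mate M v) v e e′ (trans d (∣-∣-comm (f v) (f (mate M v))))
  ...   | refl , refl = trans (+-comm (f (mate M v)) (f v)) (matched-sum v)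

module ReflectedLabelling (k : ℕ) (T : SimpleGraph (suc (Reflection.S k))) (M : PerfectMatching T)
                          (f : Fin (suc (Reflection.S k)) → ℕ) (sg : IsStronglyGraceful T M f) where
  open Reflection k
  open Labelling T M f sg

  ≤E⇒≤S : ∀ {a} → a ≤ numEdges T → a ≤ S
  ≤E⇒≤S {a} = subst (a ≤_) numEdges≡n∸1

  ≤S⇒≤E : ∀ {a} → a ≤ S → a ≤ numEdges T
  ≤S⇒≤E {a} = subst (a ≤_) (sym numEdges≡n∸1)

  label≤S : ∀ v → f v ≤ S
  label≤S v = ≤E⇒≤S (labels-bounded v)

  ∣-∣≤S : ∀ i j → ∣ f i - f j ∣ ≤ S
  ∣-∣≤S i j = ≤-trans (∣m-n∣≤m⊔n (f i) (f j)) (⊔-lub (label≤S i) (label≤S j))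

  odd-label-on-matching : ∀ {w} → w ≤ k → ∃ λ v → ∣ f v - f (mate M v) ∣ ≡ ⟦ w , true ⟧
  odd-label-on-matching {w} w≤k
    with labels-onto (k ∸ w) (≤S⇒≤E (≤-trans (m∸n≤m k w) k≤S))
  ... | v , fv≡ = v , trans (cong₂ ∣_-_∣ fv≡ fmv≡) (∣m-m+n∣≡n (k ∸ w) ⟦ w , true ⟧)
    where
    fmv≡ : f (mate M v) ≡ (k ∸ w) + ⟦ w , true ⟧
    fmv≡ = +-cancelˡ-≡ (k ∸ w) _ _
             (trans (cong (_+ f (mate M v)) (sym fv≡)) (trans (matched-sum v) (sym (centred-pair w≤k))))

  odd-edge-complementary : ∀ {i j} → IsEdge T i j → Parity true ∣ f i - f j ∣ → f i + f j ≡ S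
  odd-edge-complementary {i} {j} e (w , d≡)
    with odd-label-on-matching (⟦⟧≤⟦⟧⇒≤ {w} {true} (subst (_≤ S) d≡ (∣-∣≤S i j)))
  ... | v , dv = matching-edge-label-unique v e (trans d≡ (sym dv))

  edge-kind : ∀ {i j} → IsEdge T i j → EdgeKind (f i) (f j)
  edge-kind {i} {j} e with digits (label≤S i) | digits (label≤S j)
  ... | q , r , q≤k , fi≡ | p , s , p≤k , fj≡ with r ≟ᵇ s
  ...   | yes refl = same-parity r q≤k p≤k fi≡ fj≡
  ...   | no r≢s =
    complementary (odd-edge-complementary e (∣-∣-Parity {true} (f i) (f j) (q + p , sum≡)))
    where
    sum≡ : f i + f j ≡ ⟦ q + p , true ⟧
    sum≡ = trans (cong₂ _+_ fi≡ (trans fj≡ (cong ⟦ p ,_⟧ (¬-not (r≢s ∘ sym))))) (⟦⟧+⟦⟧-opposite q p r)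

  reflected : IsStronglyGraceful T M (g ∘ f)
  reflected = (bounded , injective , onto , distinct) , complemented
    where
    bounded : ∀ v → g (f v) ≤ numEdges T
    bounded v = ≤S⇒≤E (g-≤ (label≤S v))
    injective : ∀ u v → g (f u) ≡ g (f v) → u ≡ v
    injective u v e = labels-injective u v (g-injective (label≤S u) (label≤S v) e)
    onto : ∀ a → a ≤ numEdges T → ∃ λ v → g (f v) ≡ a
    onto a a≤E with labels-onto (g a) (≤S⇒≤E (g-≤ (≤E⇒≤S a≤E)))
    ... | v , fv≡ga = v , trans (cong g fv≡ga) (g-involutive (≤E⇒≤S a≤E))
    distinct : ∀ i j i′ j′ → IsEdge T i j → IsEdge T i′ j′ →
               ∣ g (f i) - g (f j) ∣ ≡ ∣ g (f i′) - g (f j′) ∣ → i ≡ i′ × j ≡ j′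
    complemented : ∀ x y → InMatching M x y → g (f x) + g (f y) ≡ S
    complemented x y xy = g-complement (f x) (f y) (proj₂ sg x y xy)
    distinct i j i′ j′ e e′ d =
      edge-labels-distinct i j i′ j′ e e′ (g-∣-∣-injective (edge-kind e) (edge-kind e′) d)

theorem3 : (n : ℕ) (T : SimpleGraph n) → IsTree T →
    (M : PerfectMatching T) → StronglyGraceful T M →
    IsGenStronglyGracefulPerm T M (g₂ n)
theorem3 n T _ M (f , sg) with Labelling.order≡2+2k T M f sg
... | k , refl = Reflection.g-isPermutation k , λ f′ sg′ → ReflectedLabelling.reflected k T M f′ sg′
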